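{- Let $X=\prod_{i=1}^n\{0,\dots,m_i\}$, $f\colon X\to X$, and $F=\beta\circ f\circ\beta^{ -1}\circ\psi\colon\{0,1\}^m\to\{0,1\}^m$. (i) If for some $y\in\{0,1\}^m$ the local interaction graph $G_F(y)$ contains a cycle, then $G_f(x)$ contains a cycle, where $x=\beta^{ -1}(\psi(y))$; moreover, if the cycle in $G_F(y)$ is negative, then $G_f(x)$ contains a negative cycle. (ii) If the global interaction graph $G_F$ contains a cycle, then the global interaction graph $G_f$ contains a cycle; moreover, if the cycle in $G_F$ is negative, then $G_f$ contains a negative cycle.
   Context: $m_i\ge1$, $m=\sum_i m_i$; coordinates of $\{0,1\}^m$ are indexed by $I=\{(i,j)\mid 1\le i\le n,\,1\le j\le m_i\}$. $\beta\colon X\to\{0,1\}^m$ is given by $\beta_{i,j}(x)=1$ iff $x_i\ge j$; $\mathcal{A}=\beta(X)$ and $\beta^{ -1}$ is the inverse of $\beta\colon X\to\mathcal{A}$. $\psi\colon\{0,1\}^m\to\mathcal{A}$ is defined by $\psi_{i,j}(y)=1$ iff $\sum_{k=1}^{m_i}y_{i,k}\ge j$. $e^k$ is the $k$-th unit vector, $\mathrm{sign}(0)=0$. For a map $g\colon Y\to Y$, $Y$ a set of integer vectors with coordinates indexed by a finite set $J$, the local interaction graph $G_g(x)$ at $x\in Y$ has vertex set $J$ and an edge from $j$ to $i$ with sign $s=s_1\,\mathrm{sign}(g_i(x+s_1e^j)-g_i(x))$ whenever $s_1\in\{ -1,1\}$, $x+s_1e^j\in Y$ and $s\ne0$. The global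 interaction graph $G_g$ has an edge $j\to i$ of sign $s$ iff some $G_g(x)$ has such an edge. Cycles are elementary directed cycles (loops allowed); the sign of a cycle is the product of its edge signs. -}

module Defs where

open import Data.Nat as ℕ using (ℕ; zero; suc; _≤ᵇ_)
open import Data.Fin as Fin using (Fin; zero; suc; toℕ; fromℕ<; inject₁)
open import Data.Integer as ℤ using (ℤ; +_; -[1+_]; 0ℤ; 1ℤ; -1ℤ; _+_; _*_; _-_)
open import Data.Bool using (Bool; true; false; if_then_else_)
open import Data.Product using (Σ; _×_; _,_)
open import Data.Product.Properties as ΣP using ()
open import Data.Sum using (_⊎_)
open import Relation.Nullary using (does; ¬_)
open import Relation.Binary.Definitions using (DecidableEquality)
open import Relation.Binary.PropositionalEquality using (_≡_; _≢_)

sgn : ℤ → ℤ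
sgn (+ zero)  = 0ℤ
sgn (+ suc _) = 1ℤ
sgn -[1+ _ ]  = -1ℤ

unitVec : {J : Set} → DecidableEquality J → J → J → ℤ
unitVec _≟_ j k = if does (j ≟ k) then 1ℤ else 0ℤ

-- A set Y of integer vectors with coordinates indexed by J is presented
-- as a type Y together with its (injective) embedding ι : Y → (J → ℤ).
LocalEdge : {Y J : Set} → (Y → J → ℤ) → DecidableEquality J →
            (Y → Y) → Y → J → J → ℤ → Set
LocalEdge {Y} {J} ι deq g x j i s =
  Σ ℤ λ s₁ → (s₁ ≡ 1ℤ ⊎ s₁ ≡ -1ℤ) ×
  Σ Y λ x' → (∀ k → ι x' k ≡ ι x k + s₁ * unitVec deq j k) ×
  (s ≡ s₁ * sgn (ι (g x') i - ι (g x) i)) × (s ≢ 0ℤ)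

GlobalEdge : {Y J : Set} → (Y → J → ℤ) → DecidableEquality J →
             (Y → Y) → J → J → ℤ → Set
GlobalEdge {Y} ι deq g j i s = Σ Y λ x → LocalEdge ι deq g x j i s

csuc : ∀ {k} → Fin (suc k) → Fin (suc k)
csuc {k} t with suc (toℕ t) ℕ.<? suc k
... | Relation.Nullary.yes p = fromℕ< p
... | Relation.Nullary.no  _ = zero

prodℤ : ∀ {k} → (Fin k → ℤ) → ℤ
prodℤ {zero}  _ = 1ℤ
prodℤ {suc k} s = s zero * prodℤ (λ t → s (suc t))

-- Elementary directed cycle (loops allowed) in a signed digraph on J:
-- distinct vertices v_0,…,v_k with edges v_t → v_{t+1 mod (k+1)} of sign s_t.
record Cycle {J : Set} (E : J → J → ℤ → Set) : Set where
  field
    len   : ℕ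
    vs    : Fin (suc len) → J
    inj   : ∀ a b → vs a ≡ vs b → a ≡ b
    signs : Fin (suc len) → ℤ
    edges : ∀ t → E (vs t) (vs (csuc t)) (signs t)

cycleSign : {J : Set} {E : J → J → ℤ → Set} → Cycle E → ℤ
cycleSign c = prodℤ (Cycle.signs c)

HasCycle : {J : Set} → (J → J → ℤ → Set) → Set
HasCycle E = Cycle E

HasNegCycle : {J : Set} → (J → J → ℤ → Set) → Set
HasNegCycle E = Σ (Cycle E) λ c → cycleSign c ≡ -1ℤ

X : {n : ℕ} → (Fin n → ℕ) → Set
X {n} ms = (i : Fin n) → Fin (suc (ms i))

ιX : {n : ℕ} {ms : Fin n → ℕ} → X ms → Fin n → ℤ
ιX x i = + toℕ (x i)

-- index set I = {(i,j) | 1 ≤ j ≤ m_i}; (i , j') encodes j = toℕ j' + 1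
I : {n : ℕ} → (Fin n → ℕ) → Set
I {n} ms = Σ (Fin n) λ i → Fin (ms i)

decI : {n : ℕ} (ms : Fin n → ℕ) → DecidableEquality (I ms)
decI ms = ΣP.≡-dec Fin._≟_ Fin._≟_

Cube : {n : ℕ} → (Fin n → ℕ) → Set
Cube ms = I ms → Bool

ιC : {n : ℕ} {ms : Fin n → ℕ} → Cube ms → I ms → ℤ
ιC y k = if y k then 1ℤ else 0ℤ

β : {n : ℕ} {ms : Fin n → ℕ} → X ms → Cube ms
β x (i , j') = suc (toℕ j') ≤ᵇ toℕ (x i)

countOnes : ∀ k → (Fin k → Bool) → Fin (suc k)
countOnes zero    _ = zero
countOnes (suc k) b = if b zero then suc (countOnes k (λ t → b (suc t)))
                                else inject₁ (countOnes k (λ t → b (suc t)))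

ψ : {n : ℕ} {ms : Fin n → ℕ} → Cube ms → Cube ms
ψ {ms = ms} y (i , j') = suc (toℕ j') ≤ᵇ toℕ (countOnes (ms i) (λ k → y (i , k)))

-- β⁻¹ on 𝒜 = β(X): a ∈ 𝒜 has a_{i,·} = (1,…,1,0,…,0) with x_i ones,
-- so β⁻¹(a)_i is the number of ones in row i.
βinv : {n : ℕ} {ms : Fin n → ℕ} → Cube ms → X ms
βinv {ms = ms} a i = countOnes (ms i) (λ k → a (i , k))

Fmap : {n : ℕ} {ms : Fin n → ℕ} → (X ms → X ms) → Cube ms → Cube ms
Fmap f y = β (f (βinv (ψ y)))

Gf-loc : {n : ℕ} {ms : Fin n → ℕ} → (X ms → X ms) → X ms → Fin n → Fin n → ℤ → Set
Gf-loc f x = LocalEdge ιX Fin._≟_ f x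

Gf : {n : ℕ} {ms : Fin n → ℕ} → (X ms → X ms) → Fin n → Fin n → ℤ → Set
Gf f = GlobalEdge ιX Fin._≟_ f

GF-loc : {n : ℕ} {ms : Fin n → ℕ} → (X ms → X ms) → Cube ms → I ms → I ms → ℤ → Set
GF-loc {ms = ms} f y = LocalEdge ιC (decI ms) (Fmap f) y

GF : {n : ℕ} {ms : Fin n → ℕ} → (X ms → X ms) → I ms → I ms → ℤ → Set
GF {ms = ms} f = GlobalEdge ιC (decI ms) (Fmap f)

-- The projection (i , j) ↦ i maps every edge of G_F(y) to an edge of the same sign
-- of G_f(x), x = β⁻¹(ψ(y)): β⁻¹ ∘ ψ sends y to its vector of row sums, so a unit
-- step in coordinate (a , j) of the cube is a unit step in coordinate a of X, and
-- the threshold β_{b,j} ∘ f can only change in the direction in which f_b changes.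
-- A cycle of G_F thus projects to a closed walk of G_f with the same sign; as all
-- edge signs are ±1, a closed walk contains an elementary cycle, and a negative
-- one if the walk is negative.
module Submission where

open import Defs
open import Data.Nat as ℕ using (ℕ; zero; suc; _≤_; _<_; s≤s; z≤n; _≤ᵇ_)
import Data.Nat.Properties as ℕP
open import Data.Fin as Fin using (Fin; zero; suc; toℕ; fromℕ; inject₁; lower₁; punchIn)
import Data.Fin.Properties as FP
open import Data.Integer as ℤ using (ℤ; +_; -[1+_]; 0ℤ; 1ℤ; -1ℤ; _+_; _*_; _-_)
import Data.Integer.Properties as ℤP
open import Algebra.Properties.Semiring.Sum ℤP.+-*-semiring
  using (sum; sum-cong-≗; ∑-distrib-+; *-distribˡ-sum; sum-remove; sum-replicate-zero)
open import Data.Bool using (Bool; true; false; if_then_else_; T)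
open import Data.Unit using (tt)
open import Data.Product using (Σ; _×_; _,_; proj₁; proj₂)
open import Data.Sum using (_⊎_; inj₁; inj₂)
open import Data.Empty using (⊥-elim)
open import Relation.Nullary using (Dec; yes; no)
open import Relation.Binary.Definitions using (DecidableEquality)
open import Relation.Binary.PropositionalEquality
open import Function using (_∘_)
open import Function.Definitions using (Injective)

IsUnit : ℤ → Set
IsUnit s = s ≡ 1ℤ ⊎ s ≡ -1ℤ

IsUnit-* : ∀ {a b} → IsUnit a → IsUnit b → IsUnit (a * b)
IsUnit-* (inj₁ refl) (inj₁ refl) = inj₁ refl
IsUnit-* (inj₁ refl) (inj₂ refl) = inj₂ refl
IsUnit-* (inj₂ refl) (inj₁ refl) = inj₂ refl
IsUnit-* (inj₂ refl) (inj₂ refl) = inj₁ refl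

sgn-isUnit : ∀ z → sgn z ≢ 0ℤ → IsUnit (sgn z)
sgn-isUnit (+ zero)  sgn≢0 = ⊥-elim (sgn≢0 refl)
sgn-isUnit (+ suc _) _     = inj₁ refl
sgn-isUnit -[1+ _ ]  _     = inj₂ refl

LocalEdge-isUnit : ∀ {Y J : Set} (ι : Y → J → ℤ) (deq : DecidableEquality J)
  (g : Y → Y) (x : Y) (j i : J) {s} → LocalEdge ι deq g x j i s → IsUnit s
LocalEdge-isUnit ι _ g x _ i (s₁ , s₁-unit , x' , _ , refl , s≢0) =
  IsUnit-* s₁-unit (sgn-isUnit (ι (g x') i - ι (g x) i) sgnΔ≢0)
  where
  sgnΔ≢0 : sgn (ι (g x') i - ι (g x) i) ≢ 0ℤ
  sgnΔ≢0 sgnΔ≡0 = s≢0 (trans (cong (s₁ *_) sgnΔ≡0) (ℤP.*-zeroʳ s₁))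

csuc-inject₁ : ∀ {k} (t : Fin k) → csuc (inject₁ t) ≡ suc t
csuc-inject₁ {k} t with suc (toℕ (inject₁ t)) ℕ.<? suc k
... | yes p = FP.toℕ-injective (trans (FP.toℕ-fromℕ< p) (cong suc (FP.toℕ-inject₁ t)))
... | no ¬p = ⊥-elim (¬p (s≤s (FP.inject₁ℕ< t)))

csuc-fromℕ : ∀ k → csuc (fromℕ k) ≡ zero
csuc-fromℕ k with suc (toℕ (fromℕ k)) ℕ.<? suc k
... | yes p = ⊥-elim (ℕP.<-irrefl (FP.toℕ-fromℕ k) (ℕP.≤-pred p))
... | no _  = refl

csuc-elim : ∀ {k} (P : Fin (suc k) → Fin (suc k) → Set) →
  (∀ t → P (inject₁ t) (suc t)) → P (fromℕ k) zero → ∀ t → P t (csuc t)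
csuc-elim {k} P inner last t with k ℕ.≟ toℕ t
... | yes k≡t = subst (λ t → P t (csuc t)) t≡last
                  (subst (P (fromℕ k)) (sym (csuc-fromℕ k)) last)
  where
  t≡last : fromℕ k ≡ t
  t≡last = FP.toℕ-injective (trans (FP.toℕ-fromℕ k) k≡t)
... | no k≢t = subst (λ t → P t (csuc t)) (FP.inject₁-lower₁ t k≢t)
                 (subst (P (inject₁ (lower₁ t k≢t))) (sym (csuc-inject₁ (lower₁ t k≢t)))
                   (inner (lower₁ t k≢t)))

module Walks {J : Set} (E : J → J → ℤ → Set) where

  infixr 5 _◅_

  data Walk : J → J → Set where
    []  : ∀ {u} → Walk u u
    _◅_ : ∀ {u v w s} → E u v s → Walk v w → Walk u w

  private variable u v w : J

  length : Walk u w → ℕ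
  length []      = 0
  length (_ ◅ W) = suc (length W)

  sign : Walk u w → ℤ
  sign []                = 1ℤ
  sign (_◅_ {s = s} _ W) = s * sign W

  vertex : (W : Walk u w) → Fin (suc (length W)) → J
  vertex {u} []      _       = u
  vertex {u} (_ ◅ W) zero    = u
  vertex     (_ ◅ W) (suc t) = vertex W t

  vertex-zero : (W : Walk u w) → vertex W zero ≡ u
  vertex-zero []      = refl
  vertex-zero (_ ◅ _) = refl

  vertex-last : (W : Walk u w) → vertex W (fromℕ (length W)) ≡ w
  vertex-last []      = refl
  vertex-last (_ ◅ W) = vertex-last W

  Simple : Walk u w → Set
  Simple W = Injective _≡_ _≡_ (vertex W)

  _∉_ : J → Walk v w → Set
  u ∉ W = ∀ t → vertex W t ≢ u

  []-simple : Simple ([] {u})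
  []-simple {x = zero} {y = zero} _ = refl

  ◅-simple : ∀ {s} {e : E u v s} {W : Walk v w} → Simple W → u ∉ W → Simple (e ◅ W)
  ◅-simple simple u∉W {x = zero}  {y = zero}  _  = refl
  ◅-simple simple u∉W {x = zero}  {y = suc b} eq = ⊥-elim (u∉W b (sym eq))
  ◅-simple simple u∉W {x = suc a} {y = zero}  eq = ⊥-elim (u∉W a eq)
  ◅-simple simple u∉W {x = suc a} {y = suc b} eq = cong suc (simple eq)

  ◅-simple⁻ : ∀ {s} {e : E u v s} {W : Walk v w} → Simple (e ◅ W) → Simple W × u ∉ W
  ◅-simple⁻ simple =
    FP.suc-injective ∘ simple , λ t eq → FP.0≢1+n (simple {x = zero} {y = suc t} (sym eq))

  signsThen : (W : Walk u w) → ℤ → Fin (suc (length W)) → ℤ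
  signsThen []                s zero    = s
  signsThen (_◅_ {s = s'} _ W) s zero    = s'
  signsThen (_ ◅ W)           s (suc t) = signsThen W s t

  prod-signsThen : (W : Walk u w) (s : ℤ) → prodℤ (signsThen W s) ≡ sign W * s
  prod-signsThen []                 s = trans (ℤP.*-identityʳ s) (sym (ℤP.*-identityˡ s))
  prod-signsThen (_◅_ {s = s'} _ W) s =
    trans (cong (s' *_) (prod-signsThen W s)) (sym (ℤP.*-assoc s' (sign W) s))

  signsThen-last : (W : Walk u w) (s : ℤ) → signsThen W s (fromℕ (length W)) ≡ s
  signsThen-last []      s = refl
  signsThen-last (_ ◅ W) s = signsThen-last W s

  vertex-edge : (W : Walk u w) (s : ℤ) (t : Fin (length W)) →
    E (vertex W (inject₁ t)) (vertex W (suc t)) (signsThen W s (inject₁ t))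
  vertex-edge (_◅_ {s = s'} e W) s zero    = subst (λ z → E _ z s') (sym (vertex-zero W)) e
  vertex-edge (_ ◅ W)           s (suc t) = vertex-edge W s t

  close : ∀ {s} → E w u s → (W : Walk u w) → Simple W →
    Σ (Cycle E) λ c → cycleSign c ≡ sign W * s
  close {w} {u} {s} e W simple = cycle , prod-signsThen W s
    where
    last : E (vertex W (fromℕ (length W))) (vertex W zero) (signsThen W s (fromℕ (length W)))
    last rewrite vertex-last W | vertex-zero W | signsThen-last W s = e
    cycle : Cycle E
    cycle = record
      { len   = length W
      ; vs    = vertex W
      ; inj   = λ _ _ → simple
      ; signs = signsThen W s
      ; edges = csuc-elim (λ a b → E (vertex W a) (vertex W b) (signsThen W s a))
                  (vertex-edge W s) last
      }

  record Split (u : J) (W : Walk v w) : Set where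
    field
      prefix        : Walk v u
      suffix        : Walk u w
      prefix-simple : Simple prefix
      suffix-simple : Simple suffix
      sign-split    : sign W ≡ sign prefix * sign suffix
      prefix-⊆      : ∀ t → Σ (Fin (suc (length W))) λ t' →
                        vertex prefix t ≡ vertex W t'
  open Split

  split : DecidableEquality J → (u : J) (W : Walk v w) → Simple W → u ∉ W ⊎ Split u W
  split _≟_ u ([] {v}) _ with v ≟ u
  ... | yes refl = inj₂ record
    { prefix = [] ; suffix = [] ; prefix-simple = []-simple ; suffix-simple = []-simple
    ; sign-split = refl ; prefix-⊆ = λ t → t , refl }
  ... | no v≢u = inj₁ λ { zero → v≢u }
  split _≟_ u (_◅_ {v} {s = s} e W) simple with v ≟ u | ◅-simple⁻ simple
  ... | yes refl | _ = inj₂ record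
    { prefix = [] ; suffix = e ◅ W ; prefix-simple = []-simple ; suffix-simple = simple
    ; sign-split = sym (ℤP.*-identityˡ _) ; prefix-⊆ = λ { zero → zero , refl } }
  ... | no v≢u | W-simple , v∉W with split _≟_ u W W-simple
  ...   | inj₁ u∉W = inj₁ λ { zero → v≢u ; (suc t) → u∉W t }
  ...   | inj₂ sp = inj₂ record
    { prefix        = e ◅ prefix sp
    ; suffix        = suffix sp
    ; prefix-simple = ◅-simple (prefix-simple sp) v∉prefix
    ; suffix-simple = suffix-simple sp
    ; sign-split    = trans (cong (s *_) (sign-split sp))
                        (sym (ℤP.*-assoc s (sign (prefix sp)) (sign (suffix sp))))
    ; prefix-⊆      = λ { zero → zero , refl
                        ; (suc t) → suc (proj₁ (prefix-⊆ sp t)) , proj₂ (prefix-⊆ sp t) }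
    }
    where
    v∉prefix : v ∉ prefix sp
    v∉prefix t eq = let t' , eq' = prefix-⊆ sp t in v∉W t' (trans (sym eq') eq)

  module _ (_≟_ : DecidableEquality J) (edge-isUnit : ∀ {u v s} → E u v s → IsUnit s) where

    sign-isUnit : (W : Walk u w) → IsUnit (sign W)
    sign-isUnit []      = inj₁ refl
    sign-isUnit (e ◅ W) = IsUnit-* (edge-isUnit e) (sign-isUnit W)

    -- A loop of sign +1 inside the walk is cut out without changing its sign;
    -- a loop of sign -1 is itself a negative cycle.
    simplify : (W : Walk u w) →
      (Σ (Walk u w) λ Q → Simple Q × sign Q ≡ sign W) ⊎ HasNegCycle E
    simplify [] = inj₁ ([] , []-simple , refl)
    simplify (_◅_ {u} {s = s} e W) with simplify W
    ... | inj₂ negative = inj₂ negative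
    ... | inj₁ (Q , Q-simple , sQ≡sW) with split _≟_ u Q Q-simple
    ...   | inj₁ u∉Q = inj₁ (e ◅ Q , ◅-simple Q-simple u∉Q , cong (s *_) sQ≡sW)
    ...   | inj₂ sp with close e (prefix sp) (prefix-simple sp)
                       | IsUnit-* (sign-isUnit (prefix sp)) (edge-isUnit e)
    ...     | c , c≡ | inj₂ loop≡-1 = inj₂ (c , trans c≡ loop≡-1)
    ...     | _ , _  | inj₁ loop≡1  = inj₁ (suffix sp , suffix-simple sp , shortcut)
      where
      open ≡-Reasoning
      p = sign (prefix sp)
      q = sign (suffix sp)
      shortcut : q ≡ s * sign W
      shortcut = begin
        q             ≡⟨ sym (ℤP.*-identityˡ q) ⟩
        1ℤ * q        ≡⟨ cong (_* q) (trans (sym loop≡1) (ℤP.*-comm p s)) ⟩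
        (s * p) * q   ≡⟨ ℤP.*-assoc s p q ⟩
        s * (p * q)   ≡⟨ cong (s *_) (sym (sign-split sp)) ⟩
        s * sign Q    ≡⟨ cong (s *_) sQ≡sW ⟩
        s * sign W    ∎

    closedWalk⇒cycle : (W : Walk u u) → 0 < length W →
      Σ (Cycle E) λ c → cycleSign c ≡ sign W ⊎ cycleSign c ≡ -1ℤ
    closedWalk⇒cycle (_◅_ {s = s} e W) _ with simplify W
    ... | inj₂ (c , negative) = c , inj₂ negative
    ... | inj₁ (Q , Q-simple , sQ≡sW) with close e Q Q-simple
    ...   | c , c≡ =
      c , inj₁ (trans c≡ (trans (cong (_* s) sQ≡sW) (ℤP.*-comm (sign W) s)))

  chain : ∀ {k w} (v : Fin (suc k) → J) (σ : Fin (suc k) → ℤ) →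
    (∀ t → E (v (inject₁ t)) (v (suc t)) (σ (inject₁ t))) →
    E (v (fromℕ k)) w (σ (fromℕ k)) → Walk (v zero) w
  chain {zero}  v σ inner last = last ◅ []
  chain {suc k} v σ inner last = inner zero ◅ chain (v ∘ suc) (σ ∘ suc) (inner ∘ suc) last

  length-chain : ∀ {k w} v σ inner last → length (chain {k} {w} v σ inner last) ≡ suc k
  length-chain {zero}  v σ inner last = refl
  length-chain {suc k} v σ inner last =
    cong suc (length-chain (v ∘ suc) (σ ∘ suc) (inner ∘ suc) last)

  sign-chain : ∀ {k w} v σ inner last → sign (chain {k} {w} v σ inner last) ≡ prodℤ σ
  sign-chain {zero}  v σ inner last = refl
  sign-chain {suc k} v σ inner last =
    cong (σ zero *_) (sign-chain (v ∘ suc) (σ ∘ suc) (inner ∘ suc) last)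

  module _ {J' : Set} {E' : J' → J' → ℤ → Set} (π : J' → J)
    (π-edge : ∀ {a b s} → E' a b s → E (π a) (π b) s) (c : Cycle E') where

    open Cycle c

    private
      inner : ∀ t → E (π (vs (inject₁ t))) (π (vs (suc t))) (signs (inject₁ t))
      inner t = subst (λ t' → E (π (vs (inject₁ t))) (π (vs t')) (signs (inject₁ t)))
                  (csuc-inject₁ t) (π-edge (edges (inject₁ t)))
      last : E (π (vs (fromℕ len))) (π (vs zero)) (signs (fromℕ len))
      last = subst (λ t' → E (π (vs (fromℕ len))) (π (vs t')) (signs (fromℕ len)))
               (csuc-fromℕ len) (π-edge (edges (fromℕ len)))

    cycleImage : Walk (π (vs zero)) (π (vs zero))
    cycleImage = chain (π ∘ vs) signs inner last

    length-cycleImage : length cycleImage ≡ suc len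
    length-cycleImage = length-chain (π ∘ vs) signs inner last

    sign-cycleImage : sign cycleImage ≡ cycleSign c
    sign-cycleImage = sign-chain (π ∘ vs) signs inner last

cycles-project : {J J' : Set} {E : J → J → ℤ → Set} {E' : J' → J' → ℤ → Set} →
  DecidableEquality J → (∀ {u v s} → E u v s → IsUnit s) →
  (π : J' → J) → (∀ {a b s} → E' a b s → E (π a) (π b) s) →
  (HasCycle E' → HasCycle E) × (HasNegCycle E' → HasNegCycle E)
cycles-project {E = E} _≟_ edge-isUnit π π-edge = proj₁ ∘ cycleOf , negativeCycleOf
  where
  open Walks E
  cycleOf : (c : Cycle _) →
    Σ (Cycle E) λ c' → cycleSign c' ≡ sign (cycleImage π π-edge c) ⊎ cycleSign c' ≡ -1ℤ
  cycleOf c = closedWalk⇒cycle _≟_ edge-isUnit (cycleImage π π-edge c)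
                (subst (0 <_) (sym (length-cycleImage π π-edge c)) (s≤s z≤n))
  negativeCycleOf : HasNegCycle _ → HasNegCycle E
  negativeCycleOf (c , negative) with cycleOf c
  ... | c' , inj₁ c'≡ = c' , trans c'≡ (trans (sign-cycleImage π π-edge c) negative)
  ... | c' , inj₂ c'≡ = c' , c'≡

sum-zero : ∀ {k} (g : Fin k → ℤ) → (∀ t → g t ≡ 0ℤ) → sum g ≡ 0ℤ
sum-zero {k} g g≡0 = trans (sum-cong-≗ g≡0) (sum-replicate-zero k)

sum-indicator : ∀ {k} (j : Fin k) (g : Fin k → ℤ) →
  g j ≡ 1ℤ → (∀ t → t ≢ j → g t ≡ 0ℤ) → sum g ≡ 1ℤ
sum-indicator {suc k} j g gj≡1 g≡0 = begin
  sum g                      ≡⟨ sum-remove {i = j} g ⟩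
  g j + sum (g ∘ punchIn j)
    ≡⟨ cong₂ _+_ gj≡1 (sum-zero (g ∘ punchIn j) (λ t → g≡0 _ (FP.punchInᵢ≢i j t))) ⟩
  1ℤ                         ∎
  where open ≡-Reasoning

unitVec-≡ : ∀ {A : Set} (_≟_ : DecidableEquality A) (j : A) → unitVec _≟_ j j ≡ 1ℤ
unitVec-≡ _≟_ j with j ≟ j
... | yes _   = refl
... | no j≢j = ⊥-elim (j≢j refl)

unitVec-≢ : ∀ {A : Set} (_≟_ : DecidableEquality A) {j k : A} →
  j ≢ k → unitVec _≟_ j k ≡ 0ℤ
unitVec-≢ _≟_ {j} {k} j≢k with j ≟ k
... | yes j≡k = ⊥-elim (j≢k j≡k)
... | no _    = refl

sum-unitVec-row : ∀ {n} (ms : Fin n → ℕ) a (ja : Fin (ms a)) i →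
  sum (λ t → unitVec (decI ms) (a , ja) (i , t)) ≡ unitVec Fin._≟_ a i
sum-unitVec-row ms a ja i = by-cases (a Fin.≟ i)
  where
  snd-injective : ∀ {x y : Fin (ms a)} → _≡_ {A = I ms} (a , x) (a , y) → x ≡ y
  snd-injective refl = refl
  by-cases : Dec (a ≡ i) →
    sum (λ t → unitVec (decI ms) (a , ja) (i , t)) ≡ unitVec Fin._≟_ a i
  by-cases (yes refl) = trans
    (sum-indicator ja _ (unitVec-≡ (decI ms) (a , ja))
      (λ t t≢ja → unitVec-≢ (decI ms) (λ eq → t≢ja (sym (snd-injective eq)))))
    (sym (unitVec-≡ Fin._≟_ a))
  by-cases (no a≢i) = trans
    (sum-zero (λ t → unitVec (decI ms) (a , ja) (i , t))
      (λ t → unitVec-≢ (decI ms) (λ eq → a≢i (cong proj₁ eq))))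
    (sym (unitVec-≢ Fin._≟_ a≢i))

toℕ-countOnes : ∀ K (b : Fin K → Bool) →
  + toℕ (countOnes K b) ≡ sum (λ t → if b t then 1ℤ else 0ℤ)
toℕ-countOnes zero    b = refl
toℕ-countOnes (suc K) b with b zero
... | true  = cong (λ z → 1ℤ + z) (toℕ-countOnes K (b ∘ suc))
... | false = trans (cong +_ (FP.toℕ-inject₁ (countOnes K (b ∘ suc))))
                (trans (toℕ-countOnes K (b ∘ suc)) (sym (ℤP.+-identityˡ _)))

countOnes-staircase : ∀ K c → c ≤ K → toℕ (countOnes K (λ t → suc (toℕ t) ≤ᵇ c)) ≡ c
countOnes-staircase zero    .zero   z≤n       = refl
countOnes-staircase (suc K) zero    _         =
  trans (FP.toℕ-inject₁ _) (countOnes-staircase K zero z≤n)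
countOnes-staircase (suc K) (suc c) (s≤s c≤K) = cong suc (countOnes-staircase K c c≤K)

βinv∘ψ-rowSum : ∀ {n} {ms : Fin n → ℕ} (y : Cube ms) i →
  ιX (βinv (ψ y)) i ≡ sum (λ t → ιC y (i , t))
βinv∘ψ-rowSum {ms = ms} y i = trans
  (cong +_ (countOnes-staircase (ms i) _ (FP.toℕ≤pred[n] (countOnes (ms i) row))))
  (toℕ-countOnes (ms i) row)
  where
  row : Fin (ms i) → Bool
  row t = y (i , t)

βinv∘ψ-step : ∀ {n} {ms : Fin n → ℕ} {y y' : Cube ms} {s₁} a (ja : Fin (ms a)) →
  (∀ k → ιC y' k ≡ ιC y k + s₁ * unitVec (decI ms) (a , ja) k) →
  ∀ i → ιX (βinv (ψ y')) i ≡ ιX (βinv (ψ y)) i + s₁ * unitVec Fin._≟_ a i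
βinv∘ψ-step {ms = ms} {y} {y'} {s₁} a ja y'≡ i = begin
  ιX (βinv (ψ y')) i
    ≡⟨ βinv∘ψ-rowSum y' i ⟩
  sum (λ t → ιC y' (i , t))
    ≡⟨ sum-cong-≗ (λ t → y'≡ (i , t)) ⟩
  sum (λ t → ιC y (i , t) + s₁ * e t)
    ≡⟨ ∑-distrib-+ (λ t → ιC y (i , t)) (λ t → s₁ * e t) ⟩
  sum (λ t → ιC y (i , t)) + sum (λ t → s₁ * e t)
    ≡⟨ cong₂ _+_ (sym (βinv∘ψ-rowSum y i)) (sym (*-distribˡ-sum s₁ e)) ⟩
  ιX (βinv (ψ y)) i + s₁ * sum e
    ≡⟨ cong (λ z → ιX (βinv (ψ y)) i + s₁ * z) (sum-unitVec-row ms a ja i) ⟩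
  ιX (βinv (ψ y)) i + s₁ * unitVec Fin._≟_ a i
    ∎
  where
  open ≡-Reasoning
  e : Fin (ms i) → ℤ
  e t = unitVec (decI ms) (a , ja) (i , t)

sgn[+x]≡1 : ∀ {x} → x ≢ 0 → sgn (+ x) ≡ 1ℤ
sgn[+x]≡1 {zero}  x≢0 = ⊥-elim (x≢0 refl)
sgn[+x]≡1 {suc _} _   = refl

sgn[-x]≡-1 : ∀ {x} → x ≢ 0 → sgn (ℤ.- + x) ≡ -1ℤ
sgn[-x]≡-1 {zero}  x≢0 = ⊥-elim (x≢0 refl)
sgn[-x]≡-1 {suc _} _   = refl

sgn-pos : ∀ {p q} → q < p → sgn (+ p - + q) ≡ 1ℤ
sgn-pos {p} {q} q<p rewrite ℤP.m-n≡m⊖n p q | ℤP.⊖-≥ (ℕP.<⇒≤ q<p) =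
  sgn[+x]≡1 (ℕP.m>n⇒m∸n≢0 q<p)

sgn-neg : ∀ {p q} → p < q → sgn (+ p - + q) ≡ -1ℤ
sgn-neg {p} {q} p<q rewrite ℤP.m-n≡m⊖n p q | ℤP.⊖-< p<q =
  sgn[-x]≡-1 (ℕP.m>n⇒m∸n≢0 p<q)

threshold : ℕ → ℕ → ℤ
threshold c p = if c ≤ᵇ p then 1ℤ else 0ℤ

≤ᵇ≡true⇒≤ : ∀ c m → (c ≤ᵇ m) ≡ true → c ≤ m
≤ᵇ≡true⇒≤ c m eq = ℕP.≤ᵇ⇒≤ c m (subst T (sym eq) tt)

≤ᵇ≡false⇒> : ∀ c m → (c ≤ᵇ m) ≡ false → m < c
≤ᵇ≡false⇒> c m eq = ℕP.≰⇒> (λ c≤m → subst T eq (ℕP.≤⇒≤ᵇ c≤m))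

sgn-threshold : ∀ c p q → sgn (threshold c p - threshold c q) ≢ 0ℤ →
  sgn (threshold c p - threshold c q) ≡ sgn (+ p - + q)
sgn-threshold c p q Δ≢0 with c ≤ᵇ p in c≤ᵇp | c ≤ᵇ q in c≤ᵇq
... | true  | true  = ⊥-elim (Δ≢0 refl)
... | false | false = ⊥-elim (Δ≢0 refl)
... | true  | false = sym (sgn-pos (ℕP.<-≤-trans (≤ᵇ≡false⇒> c q c≤ᵇq) (≤ᵇ≡true⇒≤ c p c≤ᵇp)))
... | false | true  = sym (sgn-neg (ℕP.<-≤-trans (≤ᵇ≡false⇒> c p c≤ᵇp) (≤ᵇ≡true⇒≤ c q c≤ᵇq)))

project-edge : ∀ {n} {ms : Fin n → ℕ} (f : X ms → X ms) (y : Cube ms) (j i : I ms) {s : ℤ} →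
  GF-loc f y j i s → Gf-loc f (βinv (ψ y)) (proj₁ j) (proj₁ i) s
project-edge f y (a , ja) (b , jb) (s₁ , s₁-unit , y' , y'≡ , s≡ , s≢0) =
  s₁ , s₁-unit , βinv (ψ y') , βinv∘ψ-step {y = y} {y'} {s₁} a ja y'≡ ,
  trans s≡ (cong (s₁ *_) (sgn-threshold c p q Δ≢0)) , s≢0
  where
  c p q : ℕ
  c = suc (toℕ jb)
  p = toℕ (f (βinv (ψ y')) b)
  q = toℕ (f (βinv (ψ y)) b)
  Δ≢0 : sgn (threshold c p - threshold c q) ≢ 0ℤ
  Δ≢0 Δ≡0 = s≢0 (trans s≡ (trans (cong (s₁ *_) Δ≡0) (ℤP.*-zeroʳ s₁)))

theorem2 : (n : ℕ) (ms : Fin n → ℕ) → (∀ i → 1 ≤ ms i) → (f : X ms → X ms) →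
    ((y : Cube ms) →
       (HasCycle (GF-loc f y) → HasCycle (Gf-loc f (βinv (ψ y)))) ×
       (HasNegCycle (GF-loc f y) → HasNegCycle (Gf-loc f (βinv (ψ y))))) ×
    ((HasCycle (GF f) → HasCycle (Gf f)) ×
     (HasNegCycle (GF f) → HasNegCycle (Gf f)))
theorem2 n ms _ f =
  (λ y → cycles-project {E = Gf-loc f (βinv (ψ y))} {E' = GF-loc f y} Fin._≟_
            (λ {u} {v} → LocalEdge-isUnit ιX Fin._≟_ f (βinv (ψ y)) u v) proj₁
            (λ {j} {i} → project-edge f y j i)) ,
  cycles-project {E = Gf f} {E' = GF f} Fin._≟_
    (λ {u} {v} (x , e) → LocalEdge-isUnit ιX Fin._≟_ f x u v e) proj₁
    (λ {j} {i} (y , e) → βinv (ψ y) , project-edge f y j i e)
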